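{- Let $N\ge 0$, let $\sigma$ be a permutation of $[N]$, let $\ell,m\in\mathbb{Z}^N$ be arbitrary, and let $a,b$ be integers with $a+b=N-1$. Then \[ \nabla\left(\prod_{i=1}^N h_{\ell_i-m_{\sigma(i)}}\right)=\sum_{k=1}^N(\ell_k+a)\prod_{i=1}^N h_{(\ell-e_k)_i-m_{\sigma(i)}}+\sum_{k=1}^N(b-m_k)\prod_{i=1}^N h_{\ell_i-(m+e_k)_{\sigma(i)}}. \]
   Context: $R=\mathbb{Z}[x_1,\dots,x_N]$ and $\nabla=\frac{\partial}{\partial x_1}+\cdots+\frac{\partial}{\partial x_N}:R\to R$. $[N]=\{1,\dots,N\}$; $e_k\in\mathbb{Z}^N$ is the $k$-th standard basis vector; $N$-tuples are added/subtracted entrywise and $a_i$ is the $i$-th entry of $a$. For $n\in\mathbb{Z}$, $h_n=\sum x_1^{i_1}\cdots x_N^{i_N}$ over $(i_1,\dots,i_N)\in\mathbb{N}^N$ with $i_1+\cdots+i_N=n$ (so $h_0=1$, $h_n=0$ for $n<0$). -}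

module Defs where

-- Polynomials in Z[x_1,...,x_N], represented as finite formal sums of terms
-- c * x^α (α an exponent vector), compared by coefficients.

open import Data.Nat as ℕ using (ℕ; zero; suc; _∸_)
open import Data.Integer as ℤ using (ℤ; +_; -[1+_]; _*_; _+_; _-_)
open import Data.Fin using (Fin; zero; suc; _≟_)
open import Data.Vec as V using (Vec; []; _∷_; lookup; replicate; zipWith; updateAt)
open import Data.Vec.Properties using (≡-dec)
open import Data.List as L using (List; []; _∷_; _++_; map; concatMap; allFin; foldr)
open import Data.Product using (_×_; _,_)
open import Relation.Nullary using (yes; no)
open import Relation.Binary.PropositionalEquality using (_≡_)

Mono : ℕ → Set
Mono N = Vec ℕ N

Poly : ℕ → Set
Poly N = List (ℤ × Mono N)

coeff : ∀ {N} → Poly N → Mono N → ℤ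
coeff [] α = + 0
coeff ((c , β) ∷ p) α with ≡-dec ℕ._≟_ β α
... | yes _ = c + coeff p α
... | no _  = coeff p α

infix 4 _≈ᴾ_
_≈ᴾ_ : ∀ {N} → Poly N → Poly N → Set
p ≈ᴾ q = ∀ α → coeff p α ≡ coeff q α

0ᴾ : ∀ {N} → Poly N
0ᴾ = []

1ᴾ : ∀ {N} → Poly N
1ᴾ {N} = (+ 1 , replicate N 0) ∷ []

infixl 6 _+ᴾ_
_+ᴾ_ : ∀ {N} → Poly N → Poly N → Poly N
_+ᴾ_ = _++_

scale : ∀ {N} → ℤ → Poly N → Poly N
scale c = map (λ { (d , α) → (c * d , α) })

infixl 7 _*ᴾ_
_*ᴾ_ : ∀ {N} → Poly N → Poly N → Poly N
p *ᴾ q = concatMap (λ { (c , α) → map (λ { (d , β) → (c * d , zipWith ℕ._+_ α β) }) q }) p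

prodᴾ : ∀ {N} → (Fin N → Poly N) → Poly N
prodᴾ {N} f = foldr (λ i acc → f i *ᴾ acc) 1ᴾ (allFin N)

sumᴾ : ∀ {N} → (Fin N → Poly N) → Poly N
sumᴾ {N} f = foldr (λ k acc → f k +ᴾ acc) 0ᴾ (allFin N)

comps : (K n : ℕ) → List (Vec ℕ K)
comps zero zero = [] ∷ []
comps zero (suc n) = []
comps (suc K) n = concatMap (λ i → map (i ∷_) (comps K (n ∸ i))) (L.upTo (suc n))

h : ∀ {N} → ℤ → Poly N
h {N} (+ n)    = map (λ α → (+ 1 , α)) (comps N n)
h {N} -[1+ n ] = []

∂ : ∀ {N} → Fin N → Poly N → Poly N
∂ k = map (λ { (c , α) → (c * + lookup α k , updateAt α k (λ e → e ∸ 1)) })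

∇ : ∀ {N} → Poly N → Poly N
∇ {N} p = sumᴾ (λ k → ∂ k p)

_-e_ : ∀ {N} → (Fin N → ℤ) → Fin N → (Fin N → ℤ)
(v -e k) i with i ≟ k
... | yes _ = v i - + 1
... | no _  = v i

_+e_ : ∀ {N} → (Fin N → ℤ) → Fin N → (Fin N → ℤ)
(v +e k) i with i ≟ k
... | yes _ = v i + + 1
... | no _  = v i

-- ∇ is a derivation, so ∇ of a product is the sum over j of the product with
-- ∇ applied to the j-th factor.  Moreover ∇ h_n = (n + N - 1) h_{n-1}: the
-- monomial x^γ with |γ| = n - 1 arises from x^(γ+e_k) by ∂_k with multiplicity
-- γ_k + 1, and Σ_k (γ_k + 1) = n - 1 + N.  With n_i = ℓ_i - m_σ(i) this gives
--   ∇ ∏_i h_{n_i} = Σ_j (n_j + N - 1) ∏_i h_{(n - e_j)_i}.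
-- Splitting n_j + N - 1 = (ℓ_j + a) + (b - m_σ(j)) and reindexing the second
-- sum by k = σ(j) gives the two sums of the statement, because lowering n at
-- σ⁻¹(k) is the same as raising m at k.

module Submission where

open import Defs
open import Data.Bool using (Bool; true; false; _∧_)
open import Data.Nat as ℕ using (ℕ; zero; suc; _∸_; _≡ᵇ_; _<ᵇ_)
import Data.Nat.Properties as ℕP
open import Data.Integer using (ℤ; +_; -[1+_]; _+_; _-_; _*_; -_)
import Data.Integer.Properties as ℤP
open import Data.Integer.Tactic.RingSolver using (solve-∀)
open import Data.Fin as F using (Fin; zero; suc)
open import Data.Fin.Permutation using (Permutation′; _⟨$⟩ʳ_; _⟨$⟩ˡ_; inverseˡ; inverseʳ)
open import Data.Vec as V using ([]; _∷_; lookup; updateAt; zipWith; replicate)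
import Data.Vec.Properties as VP
import Data.Vec.Functional as VF
import Data.Vec.Functional.Properties as VFP
open import Data.List using (List; []; _∷_; _++_; map; concatMap; foldr; allFin; upTo; applyUpTo; tabulate; deduplicate)
open import Data.List.Properties using (foldr-cong)
open import Data.List.Membership.Propositional using (_∈_)
open import Data.List.Membership.Propositional.Properties using (∈-++⁺ˡ; ∈-++⁺ʳ; ∈-deduplicate⁺)
open import Data.List.Relation.Unary.All as All using (All; []; _∷_)
open import Data.List.Relation.Unary.Any using (here; there)
open import Data.List.Relation.Unary.AllPairs using (_∷_)
open import Data.List.Relation.Unary.Unique.Propositional using (Unique)
open import Data.List.Relation.Unary.Unique.DecPropositional.Properties using (deduplicate-!)
open import Data.Product using (_×_; _,_; proj₂)
open import Data.Empty using (⊥-elim)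
open import Function using (_∘_)
open import Relation.Nullary using (Dec; yes; no; does; ¬_)
open import Relation.Nullary.Decidable using (dec-true; dec-false)
open import Relation.Binary.PropositionalEquality
open import Relation.Binary.Definitions using (DecidableEquality)
open import Algebra.Properties.CommutativeSemigroup ℤP.+-commutativeSemigroup
  using () renaming (interchange to +-interchange)
open import Algebra.Properties.CommutativeSemigroup ℤP.*-commutativeSemigroup
  using () renaming (x∙yz≈y∙xz to *-left-comm)
open import Algebra.Properties.Semiring.Sum ℤP.+-*-semiring
  using (sum-syntax; sum-cong-≗; ∑-distrib-+; sum-permute; *-distribʳ-sum; sum-replicate-zero)

private variable
  A : Set
  M N : ℕ

𝟙 : Bool → ℤ
𝟙 true = + 1
𝟙 false = + 0

𝟙-∧ : ∀ b c → 𝟙 (b ∧ c) ≡ 𝟙 b * 𝟙 c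
𝟙-∧ true c = sym (ℤP.*-identityˡ (𝟙 c))
𝟙-∧ false c = sym (ℤP.*-zeroˡ (𝟙 c))

∑ˡ : List A → (A → ℤ) → ℤ
∑ˡ [] f = + 0
∑ˡ (x ∷ xs) f = f x + ∑ˡ xs f

∑ˡ-cong : ∀ (xs : List A) {f g : A → ℤ} → (∀ x → f x ≡ g x) → ∑ˡ xs f ≡ ∑ˡ xs g
∑ˡ-cong [] f≗g = refl
∑ˡ-cong (x ∷ xs) f≗g = cong₂ _+_ (f≗g x) (∑ˡ-cong xs f≗g)

∑ˡ-zero : ∀ {xs : List A} {f : A → ℤ} → All (λ x → f x ≡ + 0) xs → ∑ˡ xs f ≡ + 0
∑ˡ-zero [] = refl
∑ˡ-zero (fx≡0 ∷ f≡0) = cong₂ _+_ fx≡0 (∑ˡ-zero f≡0)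

∑ˡ-++ : ∀ (xs ys : List A) f → ∑ˡ (xs ++ ys) f ≡ ∑ˡ xs f + ∑ˡ ys f
∑ˡ-++ [] ys f = sym (ℤP.+-identityˡ _)
∑ˡ-++ (x ∷ xs) ys f = trans (cong (λ t → f x + t) (∑ˡ-++ xs ys f)) (sym (ℤP.+-assoc (f x) _ _))

∑ˡ-map : ∀ {B : Set} (g : A → B) xs f → ∑ˡ (map g xs) f ≡ ∑ˡ xs (f ∘ g)
∑ˡ-map g [] f = refl
∑ˡ-map g (x ∷ xs) f = cong (λ t → f (g x) + t) (∑ˡ-map g xs f)

∑ˡ-concatMap : ∀ {B : Set} (g : A → List B) xs f → ∑ˡ (concatMap g xs) f ≡ ∑ˡ xs (λ x → ∑ˡ (g x) f)
∑ˡ-concatMap g [] f = refl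
∑ˡ-concatMap g (x ∷ xs) f = trans (∑ˡ-++ (g x) _ f) (cong (λ t → ∑ˡ (g x) f + t) (∑ˡ-concatMap g xs f))

∑ˡ-*ˡ : ∀ (xs : List A) c f → ∑ˡ xs (λ x → c * f x) ≡ c * ∑ˡ xs f
∑ˡ-*ˡ [] c f = sym (ℤP.*-zeroʳ c)
∑ˡ-*ˡ (x ∷ xs) c f = trans (cong (λ t → c * f x + t) (∑ˡ-*ˡ xs c f)) (sym (ℤP.*-distribˡ-+ c (f x) _))

∑ˡ-applyUpTo : ∀ m (g : ℕ → ℕ) f → ∑ˡ (applyUpTo g m) f ≡ ∑ˡ (upTo m) (f ∘ g)
∑ˡ-applyUpTo zero g f = refl
∑ˡ-applyUpTo (suc m) g f =
  cong (λ t → f (g 0) + t) (trans (∑ˡ-applyUpTo m (g ∘ suc) f) (sym (∑ˡ-applyUpTo m suc (f ∘ g))))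

∑ˡ-upTo-𝟙 : ∀ m a (f : ℕ → ℤ) → ∑ˡ (upTo m) (λ i → 𝟙 (i ≡ᵇ a) * f i) ≡ 𝟙 (a <ᵇ m) * f a
∑ˡ-upTo-𝟙 zero a f = sym (ℤP.*-zeroˡ (f a))
∑ˡ-upTo-𝟙 (suc m) zero f = begin
    + 1 * f 0 + ∑ˡ (applyUpTo suc m) (λ i → 𝟙 (i ≡ᵇ 0) * f i)
  ≡⟨ cong (λ t → + 1 * f 0 + t) (trans (∑ˡ-applyUpTo m suc _) (∑ˡ-zero (All.universal (λ i → ℤP.*-zeroˡ (f (suc i))) (upTo m)))) ⟩
    + 1 * f 0 + + 0
  ≡⟨ ℤP.+-identityʳ _ ⟩
    + 1 * f 0
  ∎
  where open ≡-Reasoning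
∑ˡ-upTo-𝟙 (suc m) (suc a) f = begin
    + 0 * f 0 + ∑ˡ (applyUpTo suc m) (λ i → 𝟙 (i ≡ᵇ suc a) * f i)
  ≡⟨ cong₂ _+_ (ℤP.*-zeroˡ (f 0)) (trans (∑ˡ-applyUpTo m suc _) (∑ˡ-upTo-𝟙 m a (f ∘ suc))) ⟩
    + 0 + 𝟙 (a <ᵇ m) * f (suc a)
  ≡⟨ ℤP.+-identityˡ _ ⟩
    𝟙 (a <ᵇ m) * f (suc a)
  ∎
  where open ≡-Reasoning

*-𝟙-no : ∀ x {P : Set} (P? : Dec P) → ¬ P → x * 𝟙 (does P?) ≡ + 0
*-𝟙-no x P? ¬p = trans (cong (λ b → x * 𝟙 b) (dec-false P? ¬p)) (ℤP.*-zeroʳ x)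

∑ˡ-sift : ∀ (_≟_ : DecidableEquality A) (f : A → ℤ) {a xs} → Unique xs → a ∈ xs →
  ∑ˡ xs (λ x → f x * 𝟙 (does (a ≟ x))) ≡ f a
∑ˡ-sift _≟_ f {a} {_ ∷ xs} (a∉xs ∷ _) (here refl) = begin
    f a * 𝟙 (does (a ≟ a)) + ∑ˡ xs (λ x → f x * 𝟙 (does (a ≟ x)))
  ≡⟨ cong₂ _+_ (cong (λ b → f a * 𝟙 b) (dec-true (a ≟ a) refl))
               (∑ˡ-zero (All.map (λ {x} → *-𝟙-no (f x) (a ≟ x)) a∉xs)) ⟩
    f a * + 1 + + 0
  ≡⟨ trans (ℤP.+-identityʳ _) (ℤP.*-identityʳ (f a)) ⟩
    f a
  ∎
  where open ≡-Reasoning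
∑ˡ-sift _≟_ f {a} {x ∷ xs} (x∉xs ∷ xs!) (there a∈xs) = begin
    f x * 𝟙 (does (a ≟ x)) + ∑ˡ xs (λ y → f y * 𝟙 (does (a ≟ y)))
  ≡⟨ cong₂ _+_ (*-𝟙-no (f x) (a ≟ x) (λ a≡x → All.lookup x∉xs a∈xs (sym a≡x))) (∑ˡ-sift _≟_ f xs! a∈xs) ⟩
    + 0 + f a
  ≡⟨ ℤP.+-identityˡ (f a) ⟩
    f a
  ∎
  where open ≡-Reasoning

-- A weight w pairs with a polynomial Σ c_α x^α to give Σ c_α w(α).  The
-- coefficient of x^γ is the pairing with the indicator δ γ, and polynomials with
-- the same coefficients pair equally with every weight (≈ᴾ⇒≋); so the algebra is
-- done on pairings, which do not see how a polynomial is listed as terms.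
Weight : ℕ → Set
Weight N = Mono N → ℤ

⟦_⟧ : Poly N → Weight N → ℤ
⟦ [] ⟧ w = + 0
⟦ (c , α) ∷ p ⟧ w = c * w α + ⟦ p ⟧ w

infix 4 _≋_
_≋_ : Poly N → Poly N → Set
p ≋ q = ∀ w → ⟦ p ⟧ w ≡ ⟦ q ⟧ w

infixl 6 _⊕_
_⊕_ : Mono N → Mono N → Mono N
_⊕_ = zipWith ℕ._+_

exponents : Poly N → List (Mono N)
exponents = map proj₂

⟦⟧-cong-on : ∀ (p : Poly N) {w v : Weight N} → All (λ α → w α ≡ v α) (exponents p) → ⟦ p ⟧ w ≡ ⟦ p ⟧ v
⟦⟧-cong-on [] [] = refl
⟦⟧-cong-on ((c , α) ∷ p) (wα≡vα ∷ w≡v) = cong₂ _+_ (cong (c *_) wα≡vα) (⟦⟧-cong-on p w≡v)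

⟦⟧-cong : ∀ (p : Poly N) {w v : Weight N} → (∀ α → w α ≡ v α) → ⟦ p ⟧ w ≡ ⟦ p ⟧ v
⟦⟧-cong p w≗v = ⟦⟧-cong-on p (All.universal w≗v (exponents p))

⟦⟧-++ : ∀ (p q : Poly N) w → ⟦ p ++ q ⟧ w ≡ ⟦ p ⟧ w + ⟦ q ⟧ w
⟦⟧-++ [] q w = sym (ℤP.+-identityˡ _)
⟦⟧-++ ((c , α) ∷ p) q w = trans (cong (λ t → c * w α + t) (⟦⟧-++ p q w)) (sym (ℤP.+-assoc (c * w α) _ _))

⟦⟧-0ʷ : ∀ (p : Poly N) → ⟦ p ⟧ (λ _ → + 0) ≡ + 0
⟦⟧-0ʷ [] = refl
⟦⟧-0ʷ ((c , α) ∷ p) = cong₂ _+_ (ℤP.*-zeroʳ c) (⟦⟧-0ʷ p)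

⟦⟧-+ʷ : ∀ (p : Poly N) w v → ⟦ p ⟧ (λ α → w α + v α) ≡ ⟦ p ⟧ w + ⟦ p ⟧ v
⟦⟧-+ʷ [] w v = refl
⟦⟧-+ʷ ((c , α) ∷ p) w v = begin
    c * (w α + v α) + ⟦ p ⟧ (λ α → w α + v α)
  ≡⟨ cong₂ _+_ (ℤP.*-distribˡ-+ c (w α) (v α)) (⟦⟧-+ʷ p w v) ⟩
    (c * w α + c * v α) + (⟦ p ⟧ w + ⟦ p ⟧ v)
  ≡⟨ +-interchange (c * w α) (c * v α) (⟦ p ⟧ w) (⟦ p ⟧ v) ⟩
    (c * w α + ⟦ p ⟧ w) + (c * v α + ⟦ p ⟧ v)
  ∎
  where open ≡-Reasoning

⟦⟧-*ʷ : ∀ (p : Poly N) k w → ⟦ p ⟧ (λ α → k * w α) ≡ k * ⟦ p ⟧ w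
⟦⟧-*ʷ [] k w = sym (ℤP.*-zeroʳ k)
⟦⟧-*ʷ ((c , α) ∷ p) k w = begin
    c * (k * w α) + ⟦ p ⟧ (λ α → k * w α)
  ≡⟨ cong₂ _+_ (*-left-comm c k (w α)) (⟦⟧-*ʷ p k w) ⟩
    k * (c * w α) + k * ⟦ p ⟧ w
  ≡⟨ sym (ℤP.*-distribˡ-+ k _ _) ⟩
    k * (c * w α + ⟦ p ⟧ w)
  ∎
  where open ≡-Reasoning

⟦⟧-∑ˡʷ : ∀ (p : Poly N) (xs : List A) (w : A → Weight N) →
  ⟦ p ⟧ (λ α → ∑ˡ xs (λ x → w x α)) ≡ ∑ˡ xs (λ x → ⟦ p ⟧ (w x))
⟦⟧-∑ˡʷ p [] w = ⟦⟧-0ʷ p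
⟦⟧-∑ˡʷ p (x ∷ xs) w = trans (⟦⟧-+ʷ p (w x) _) (cong (λ t → ⟦ p ⟧ (w x) + t) (⟦⟧-∑ˡʷ p xs w))

⟦⟧-∑ʷ : ∀ (p : Poly N) (w : Fin M → Weight N) → ⟦ p ⟧ (λ α → ∑[ j < M ] w j α) ≡ ∑[ j < M ] ⟦ p ⟧ (w j)
⟦⟧-∑ʷ {M = zero} p w = ⟦⟧-0ʷ p
⟦⟧-∑ʷ {M = suc M} p w = trans (⟦⟧-+ʷ p (w zero) _) (cong (λ t → ⟦ p ⟧ (w zero) + t) (⟦⟧-∑ʷ p (w ∘ suc)))

⟦⟧-map : ∀ (g : ℤ × Mono N → ℤ × Mono N) (s : Mono N → ℤ) (T : Mono N → Mono N) →
  (∀ c α → g (c , α) ≡ (c * s α , T α)) → ∀ p w → ⟦ map g p ⟧ w ≡ ⟦ p ⟧ (λ α → s α * w (T α))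
⟦⟧-map g s T g≡ [] w = refl
⟦⟧-map g s T g≡ ((c , α) ∷ p) w rewrite g≡ c α =
  cong₂ _+_ (ℤP.*-assoc c (s α) (w (T α))) (⟦⟧-map g s T g≡ p w)

⟦⟧-scale : ∀ c (p : Poly N) w → ⟦ scale c p ⟧ w ≡ c * ⟦ p ⟧ w
⟦⟧-scale c p w = trans (⟦⟧-map _ (λ _ → c) (λ α → α) (λ d α → cong (_, α) (ℤP.*-comm c d)) p w) (⟦⟧-*ʷ p c w)

⟦⟧-*ᴾ : ∀ (p q : Poly N) w → ⟦ p *ᴾ q ⟧ w ≡ ⟦ p ⟧ (λ α → ⟦ q ⟧ (w ∘ (α ⊕_)))
⟦⟧-*ᴾ [] q w = refl
⟦⟧-*ᴾ ((c , α) ∷ p) q w = begin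
    ⟦ map _ q ++ p *ᴾ q ⟧ w
  ≡⟨ ⟦⟧-++ (map _ q) (p *ᴾ q) w ⟩
    ⟦ map _ q ⟧ w + ⟦ p *ᴾ q ⟧ w
  ≡⟨ cong₂ _+_ first-factor (⟦⟧-*ᴾ p q w) ⟩
    c * ⟦ q ⟧ (w ∘ (α ⊕_)) + ⟦ p ⟧ (λ α → ⟦ q ⟧ (w ∘ (α ⊕_)))
  ∎
  where
    open ≡-Reasoning
    first-factor : ⟦ map _ q ⟧ w ≡ c * ⟦ q ⟧ (w ∘ (α ⊕_))
    first-factor = trans (⟦⟧-map _ (λ _ → c) (α ⊕_) (λ d β → cong (_, α ⊕ β) (ℤP.*-comm c d)) q w)
                         (⟦⟧-*ʷ q c (w ∘ (α ⊕_)))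

∂ʷ : Fin N → Weight N → Weight N
∂ʷ k w α = + lookup α k * w (updateAt α k ℕ.pred)

⟦⟧-∂ : ∀ k (p : Poly N) w → ⟦ ∂ k p ⟧ w ≡ ⟦ p ⟧ (∂ʷ k w)
⟦⟧-∂ k p w = ⟦⟧-map _ (λ α → + lookup α k) (λ α → updateAt α k ℕ.pred) (λ _ _ → refl) p w

⟦⟧-foldr-tabulate : ∀ (F : Fin N → Poly N) (t : Fin M → Fin N) w →
  ⟦ foldr (λ k acc → F k +ᴾ acc) 0ᴾ (tabulate t) ⟧ w ≡ ∑[ j < M ] ⟦ F (t j) ⟧ w
⟦⟧-foldr-tabulate {M = zero} F t w = refl
⟦⟧-foldr-tabulate {M = suc M} F t w =
  trans (⟦⟧-++ (F (t zero)) _ w) (cong (λ s → ⟦ F (t zero) ⟧ w + s) (⟦⟧-foldr-tabulate F (t ∘ suc) w))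

⟦⟧-sumᴾ : ∀ (F : Fin N → Poly N) w → ⟦ sumᴾ F ⟧ w ≡ ∑[ k < N ] ⟦ F k ⟧ w
⟦⟧-sumᴾ F = ⟦⟧-foldr-tabulate F (λ k → k)

_≟ᵐ_ : DecidableEquality (Mono N)
_≟ᵐ_ = VP.≡-dec ℕ._≟_

δ : Mono N → Weight N
δ γ α = 𝟙 (does (α ≟ᵐ γ))

coeff≡⟦⟧δ : ∀ (p : Poly N) γ → coeff p γ ≡ ⟦ p ⟧ (δ γ)
coeff≡⟦⟧δ [] γ = refl
coeff≡⟦⟧δ ((c , β) ∷ p) γ with β ≟ᵐ γ
... | yes _ = cong₂ _+_ (sym (ℤP.*-identityʳ c)) (coeff≡⟦⟧δ p γ)
... | no _ = trans (coeff≡⟦⟧δ p γ) (sym (trans (cong (_+ ⟦ p ⟧ (δ γ)) (ℤP.*-zeroʳ c)) (ℤP.+-identityˡ _)))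

≋⇒≈ᴾ : ∀ {p q : Poly N} → p ≋ q → p ≈ᴾ q
≋⇒≈ᴾ {p = p} {q} p≋q γ = trans (coeff≡⟦⟧δ p γ) (trans (p≋q (δ γ)) (sym (coeff≡⟦⟧δ q γ)))

⟦⟧-expand : ∀ (p : Poly N) {S} → Unique S → All (_∈ S) (exponents p) →
  ∀ w → ⟦ p ⟧ w ≡ ∑ˡ S (λ β → w β * coeff p β)
⟦⟧-expand p {S} S! p⊆S w = begin
    ⟦ p ⟧ w
  ≡⟨ ⟦⟧-cong-on p (All.map (λ α∈S → sym (∑ˡ-sift _≟ᵐ_ w S! α∈S)) p⊆S) ⟩
    ⟦ p ⟧ (λ α → ∑ˡ S (λ β → w β * δ β α))
  ≡⟨ ⟦⟧-∑ˡʷ p S (λ β α → w β * δ β α) ⟩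
    ∑ˡ S (λ β → ⟦ p ⟧ (λ α → w β * δ β α))
  ≡⟨ ∑ˡ-cong S (λ β → trans (⟦⟧-*ʷ p (w β) (δ β)) (cong (w β *_) (sym (coeff≡⟦⟧δ p β)))) ⟩
    ∑ˡ S (λ β → w β * coeff p β)
  ∎
  where open ≡-Reasoning

≈ᴾ⇒≋ : ∀ {p q : Poly N} → p ≈ᴾ q → p ≋ q
≈ᴾ⇒≋ {p = p} {q} p≈q w = begin
    ⟦ p ⟧ w
  ≡⟨ ⟦⟧-expand p S! (All.tabulate (∈-deduplicate⁺ _≟ᵐ_ ∘ ∈-++⁺ˡ)) w ⟩
    ∑ˡ S (λ β → w β * coeff p β)
  ≡⟨ ∑ˡ-cong S (λ β → cong (w β *_) (p≈q β)) ⟩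
    ∑ˡ S (λ β → w β * coeff q β)
  ≡⟨ ⟦⟧-expand q S! (All.tabulate (∈-deduplicate⁺ _≟ᵐ_ ∘ ∈-++⁺ʳ (exponents p))) w ⟨
    ⟦ q ⟧ w
  ∎
  where
    open ≡-Reasoning
    S = deduplicate _≟ᵐ_ (exponents p ++ exponents q)
    S! = deduplicate-! _≟ᵐ_ (exponents p ++ exponents q)

-- Coefficients of h_n and of ∇ h_n

δ-∷ : ∀ a i (γ α : Mono N) → δ (a ∷ γ) (i ∷ α) ≡ 𝟙 (i ≡ᵇ a) * δ γ α
δ-∷ a i γ α = 𝟙-∧ (i ≡ᵇ a) (does (α ≟ᵐ γ))

𝟙-≡ᵇ-∸ : ∀ a s n → 𝟙 (a <ᵇ suc n) * 𝟙 (s ≡ᵇ n ∸ a) ≡ 𝟙 (a ℕ.+ s ≡ᵇ n)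
𝟙-≡ᵇ-∸ zero s n = ℤP.*-identityˡ _
𝟙-≡ᵇ-∸ (suc a) s zero = ℤP.*-zeroˡ (𝟙 (s ≡ᵇ 0))
𝟙-≡ᵇ-∸ (suc a) s (suc n) = 𝟙-≡ᵇ-∸ a s n

∑ˡ-comps-δ : ∀ K n (γ : Mono K) → ∑ˡ (comps K n) (δ γ) ≡ 𝟙 (V.sum γ ≡ᵇ n)
∑ˡ-comps-δ zero zero [] = refl
∑ˡ-comps-δ zero (suc n) [] = refl
∑ˡ-comps-δ (suc K) n (a ∷ γ) = begin
    ∑ˡ (concatMap (λ i → map (i ∷_) (comps K (n ∸ i))) (upTo (suc n))) (δ (a ∷ γ))
  ≡⟨ ∑ˡ-concatMap (λ i → map (i ∷_) (comps K (n ∸ i))) (upTo (suc n)) (δ (a ∷ γ)) ⟩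
    ∑ˡ (upTo (suc n)) (λ i → ∑ˡ (map (i ∷_) (comps K (n ∸ i))) (δ (a ∷ γ)))
  ≡⟨ ∑ˡ-cong (upTo (suc n)) first-entry ⟩
    ∑ˡ (upTo (suc n)) (λ i → 𝟙 (i ≡ᵇ a) * 𝟙 (V.sum γ ≡ᵇ n ∸ i))
  ≡⟨ ∑ˡ-upTo-𝟙 (suc n) a (λ i → 𝟙 (V.sum γ ≡ᵇ n ∸ i)) ⟩
    𝟙 (a <ᵇ suc n) * 𝟙 (V.sum γ ≡ᵇ n ∸ a)
  ≡⟨ 𝟙-≡ᵇ-∸ a (V.sum γ) n ⟩
    𝟙 (a ℕ.+ V.sum γ ≡ᵇ n)
  ∎
  where
    open ≡-Reasoning
    first-entry : ∀ i → ∑ˡ (map (i ∷_) (comps K (n ∸ i))) (δ (a ∷ γ)) ≡ 𝟙 (i ≡ᵇ a) * 𝟙 (V.sum γ ≡ᵇ n ∸ i)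
    first-entry i = begin
        ∑ˡ (map (i ∷_) (comps K (n ∸ i))) (δ (a ∷ γ))
      ≡⟨ ∑ˡ-map (i ∷_) (comps K (n ∸ i)) (δ (a ∷ γ)) ⟩
        ∑ˡ (comps K (n ∸ i)) (λ α → δ (a ∷ γ) (i ∷ α))
      ≡⟨ ∑ˡ-cong (comps K (n ∸ i)) (δ-∷ a i γ) ⟩
        ∑ˡ (comps K (n ∸ i)) (λ α → 𝟙 (i ≡ᵇ a) * δ γ α)
      ≡⟨ ∑ˡ-*ˡ (comps K (n ∸ i)) (𝟙 (i ≡ᵇ a)) (δ γ) ⟩
        𝟙 (i ≡ᵇ a) * ∑ˡ (comps K (n ∸ i)) (δ γ)
      ≡⟨ cong (𝟙 (i ≡ᵇ a) *_) (∑ˡ-comps-δ K (n ∸ i) γ) ⟩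
        𝟙 (i ≡ᵇ a) * 𝟙 (V.sum γ ≡ᵇ n ∸ i)
      ∎

⟦⟧-monomials : ∀ (xs : List (Mono N)) w → ⟦ map (λ α → (+ 1 , α)) xs ⟧ w ≡ ∑ˡ xs w
⟦⟧-monomials [] w = refl
⟦⟧-monomials (α ∷ xs) w = cong₂ _+_ (ℤP.*-identityˡ (w α)) (⟦⟧-monomials xs w)

coeff-h : ∀ n (γ : Mono N) → coeff (h n) γ ≡ 𝟙 (does (+ V.sum γ ℤP.≟ n))
coeff-h {N} (+ n) γ = trans (coeff≡⟦⟧δ (h (+ n)) γ) (trans (⟦⟧-monomials (comps N n) (δ γ)) (∑ˡ-comps-δ N n γ))
coeff-h -[1+ n ] γ = refl

*-congˡ-on-suc : ∀ a {x y : ℤ} → (∀ {j} → a ≡ suc j → x ≡ y) → + a * x ≡ + a * y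
*-congˡ-on-suc zero {x} {y} x≡y = trans (ℤP.*-zeroˡ x) (sym (ℤP.*-zeroˡ y))
*-congˡ-on-suc (suc j) x≡y = cong (+ suc j *_) (x≡y refl)

updateAt-suc-pred : ∀ k (β : Mono N) {j} → lookup β k ≡ suc j → updateAt (updateAt β k ℕ.pred) k suc ≡ β
updateAt-suc-pred k β βₖ≡1+j = trans (VP.updateAt-updateAt k β)
  (VP.updateAt-id-local k β (trans (cong (λ e → suc (ℕ.pred e)) βₖ≡1+j) (sym βₖ≡1+j)))

updateAt-pred-suc : ∀ k (γ : Mono N) → updateAt (updateAt γ k suc) k ℕ.pred ≡ γ
updateAt-pred-suc k γ = trans (VP.updateAt-updateAt k γ) (VP.updateAt-id-local k γ refl)

∂ʷ-δ : ∀ k (γ β : Mono N) → ∂ʷ k (δ γ) β ≡ + suc (lookup γ k) * δ (updateAt γ k suc) β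
∂ʷ-δ k γ β with β ≟ᵐ updateAt γ k suc
... | yes refl = cong₂ _*_ (cong +_ (VP.lookup∘updateAt k γ))
                           (cong 𝟙 (dec-true (_ ≟ᵐ γ) (updateAt-pred-suc k γ)))
... | no β≢γ⁺ = trans (*-congˡ-on-suc (lookup β k) lowered-off)
                        (trans (ℤP.*-zeroʳ (+ lookup β k)) (sym (ℤP.*-zeroʳ (+ suc (lookup γ k)))))
  where
    lowered-off : ∀ {j} → lookup β k ≡ suc j → δ γ (updateAt β k ℕ.pred) ≡ + 0
    lowered-off βₖ≡1+j = cong 𝟙 (dec-false (_ ≟ᵐ γ)
      (λ β⁻≡γ → β≢γ⁺ (trans (sym (updateAt-suc-pred k β βₖ≡1+j)) (cong (λ α → updateAt α k suc) β⁻≡γ))))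

coeff-scale : ∀ c (p : Poly N) γ → coeff (scale c p) γ ≡ c * coeff p γ
coeff-scale c p γ = trans (coeff≡⟦⟧δ (scale c p) γ) (trans (⟦⟧-scale c p (δ γ)) (cong (c *_) (sym (coeff≡⟦⟧δ p γ))))

coeff-∂ : ∀ k (p : Poly N) γ → coeff (∂ k p) γ ≡ + suc (lookup γ k) * coeff p (updateAt γ k suc)
coeff-∂ k p γ = begin
    coeff (∂ k p) γ
  ≡⟨ trans (coeff≡⟦⟧δ (∂ k p) γ) (⟦⟧-∂ k p (δ γ)) ⟩
    ⟦ p ⟧ (∂ʷ k (δ γ))
  ≡⟨ trans (⟦⟧-cong p (∂ʷ-δ k γ)) (⟦⟧-*ʷ p (+ suc (lookup γ k)) (δ (updateAt γ k suc))) ⟩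
    + suc (lookup γ k) * ⟦ p ⟧ (δ (updateAt γ k suc))
  ≡⟨ cong (+ suc (lookup γ k) *_) (coeff≡⟦⟧δ p (updateAt γ k suc)) ⟨
    + suc (lookup γ k) * coeff p (updateAt γ k suc)
  ∎
  where open ≡-Reasoning

coeff-∇ : ∀ (p : Poly N) γ → coeff (∇ p) γ ≡ ∑[ k < N ] (+ suc (lookup γ k) * coeff p (updateAt γ k suc))
coeff-∇ p γ = trans (coeff≡⟦⟧δ (∇ p) γ) (trans (⟦⟧-sumᴾ (λ k → ∂ k p) (δ γ))
  (sum-cong-≗ (λ k → trans (sym (coeff≡⟦⟧δ (∂ k p) γ)) (coeff-∂ k p γ))))

sum-updateAt-suc : ∀ k (γ : Mono N) → V.sum (updateAt γ k suc) ≡ suc (V.sum γ)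
sum-updateAt-suc zero (a ∷ γ) = refl
sum-updateAt-suc (suc k) (a ∷ γ) = trans (cong (a ℕ.+_) (sum-updateAt-suc k γ)) (ℕP.+-suc a (V.sum γ))

∑-suc-lookup : ∀ (γ : Mono N) → ∑[ k < N ] (+ suc (lookup γ k)) ≡ + (V.sum γ ℕ.+ N)
∑-suc-lookup [] = refl
∑-suc-lookup {suc N} (a ∷ γ) =
  trans (cong (λ t → + suc a + t) (∑-suc-lookup γ))
        (cong +_ (trans (cong suc (sym (ℕP.+-assoc a (V.sum γ) N))) (sym (ℕP.+-suc (a ℕ.+ V.sum γ) N))))

𝟙-shift : ∀ s N n → + (s ℕ.+ N) * 𝟙 (does (+ suc s ℤP.≟ n)) ≡ (n + + N - + 1) * 𝟙 (does (+ s ℤP.≟ n - + 1))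
𝟙-shift s N n with + suc s ℤP.≟ n
... | yes refl = cong₂ _*_ degree (cong 𝟙 (sym (dec-true (+ s ℤP.≟ _) (sym (cancel (+ s))))))
  where
    cancel : ∀ x → + 1 + x - + 1 ≡ x
    cancel = solve-∀
    shift : ∀ x y → + 1 + x + y - + 1 ≡ x + y
    shift = solve-∀
    degree : + (s ℕ.+ N) ≡ + suc s + + N - + 1
    degree = trans (ℤP.pos-+ s N) (sym (shift (+ s) (+ N)))
... | no 1+s≢n = trans (ℤP.*-zeroʳ (+ (s ℕ.+ N)))
  (sym (*-𝟙-no (n + + N - + 1) (+ s ℤP.≟ n - + 1) s≢n-1))
  where
    uncancel : ∀ x → + 1 + (x - + 1) ≡ x
    uncancel = solve-∀
    s≢n-1 : + s ≢ n - + 1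
    s≢n-1 s≡n-1 = 1+s≢n (trans (cong (_+_ (+ 1)) s≡n-1) (uncancel n))

∇-h : ∀ n → ∇ {N} (h n) ≈ᴾ scale (n + + N - + 1) (h (n - + 1))
∇-h {N} n γ = begin
    coeff (∇ (h n)) γ
  ≡⟨ coeff-∇ (h n) γ ⟩
    ∑[ k < N ] (+ suc (lookup γ k) * coeff (h n) (updateAt γ k suc))
  ≡⟨ sum-cong-≗ (λ k → cong (+ suc (lookup γ k) *_) (trans (coeff-h n (updateAt γ k suc))
       (cong (λ s → 𝟙 (does (+ s ℤP.≟ n))) (sum-updateAt-suc k γ)))) ⟩
    ∑[ k < N ] (+ suc (lookup γ k) * 𝟙 (does (+ suc (V.sum γ) ℤP.≟ n)))
  ≡⟨ *-distribʳ-sum _ (λ k → + suc (lookup γ k)) ⟨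
    (∑[ k < N ] (+ suc (lookup γ k))) * 𝟙 (does (+ suc (V.sum γ) ℤP.≟ n))
  ≡⟨ cong (_* 𝟙 (does (+ suc (V.sum γ) ℤP.≟ n))) (∑-suc-lookup γ) ⟩
    + (V.sum γ ℕ.+ N) * 𝟙 (does (+ suc (V.sum γ) ℤP.≟ n))
  ≡⟨ 𝟙-shift (V.sum γ) N n ⟩
    (n + + N - + 1) * 𝟙 (does (+ V.sum γ ℤP.≟ n - + 1))
  ≡⟨ trans (coeff-scale (n + + N - + 1) (h (n - + 1)) γ) (cong ((n + + N - + 1) *_) (coeff-h (n - + 1) γ)) ⟨
    coeff (scale (n + + N - + 1) (h (n - + 1))) γ
  ∎
  where open ≡-Reasoning

-- Leibniz's rule for ∇

updateAt-pred-⊕ˡ : ∀ k (α β : Mono N) {j} → lookup α k ≡ suc j →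
  updateAt (α ⊕ β) k ℕ.pred ≡ updateAt α k ℕ.pred ⊕ β
updateAt-pred-⊕ˡ zero (a ∷ α) (b ∷ β) refl = refl
updateAt-pred-⊕ˡ (suc k) (a ∷ α) (b ∷ β) αₖ≡1+j = cong (a ℕ.+ b ∷_) (updateAt-pred-⊕ˡ k α β αₖ≡1+j)

updateAt-pred-⊕ʳ : ∀ k (α β : Mono N) {j} → lookup β k ≡ suc j →
  updateAt (α ⊕ β) k ℕ.pred ≡ α ⊕ updateAt β k ℕ.pred
updateAt-pred-⊕ʳ zero (a ∷ α) (b ∷ β) {j} refl = cong (λ e → ℕ.pred e ∷ α ⊕ β) (ℕP.+-suc a j)
updateAt-pred-⊕ʳ (suc k) (a ∷ α) (b ∷ β) βₖ≡1+j = cong (a ℕ.+ b ∷_) (updateAt-pred-⊕ʳ k α β βₖ≡1+j)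

-- ℕ.pred truncates at 0, but the junk monomial it then produces is weighted by
-- the exponent, which is 0.
∂ʷ-⊕ : ∀ k (w : Weight N) α β → ∂ʷ k w (α ⊕ β) ≡ ∂ʷ k (w ∘ (_⊕ β)) α + ∂ʷ k (w ∘ (α ⊕_)) β
∂ʷ-⊕ k w α β = begin
    + lookup (α ⊕ β) k * w⁻
  ≡⟨ cong (λ e → + e * w⁻) (VP.lookup-zipWith ℕ._+_ k α β) ⟩
    + (lookup α k ℕ.+ lookup β k) * w⁻
  ≡⟨ trans (cong (_* w⁻) (ℤP.pos-+ (lookup α k) (lookup β k))) (ℤP.*-distribʳ-+ w⁻ (+ lookup α k) (+ lookup β k)) ⟩
    + lookup α k * w⁻ + + lookup β k * w⁻
  ≡⟨ cong₂ _+_ (*-congˡ-on-suc (lookup α k) (cong w ∘ updateAt-pred-⊕ˡ k α β))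
               (*-congˡ-on-suc (lookup β k) (cong w ∘ updateAt-pred-⊕ʳ k α β)) ⟩
    ∂ʷ k (w ∘ (_⊕ β)) α + ∂ʷ k (w ∘ (α ⊕_)) β
  ∎
  where
    open ≡-Reasoning
    w⁻ = w (updateAt (α ⊕ β) k ℕ.pred)

∂-*ᴾ : ∀ k (p q : Poly N) → ∂ k (p *ᴾ q) ≋ ∂ k p *ᴾ q +ᴾ p *ᴾ ∂ k q
∂-*ᴾ k p q w = begin
    ⟦ ∂ k (p *ᴾ q) ⟧ w
  ≡⟨ trans (⟦⟧-∂ k (p *ᴾ q) w) (⟦⟧-*ᴾ p q (∂ʷ k w)) ⟩
    ⟦ p ⟧ (λ α → ⟦ q ⟧ (∂ʷ k w ∘ (α ⊕_)))
  ≡⟨ ⟦⟧-cong p (λ α → trans (⟦⟧-cong q (∂ʷ-⊕ k w α)) (⟦⟧-+ʷ q _ _)) ⟩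
    ⟦ p ⟧ (λ α → ⟦ q ⟧ (λ β → ∂ʷ k (w ∘ (_⊕ β)) α) + ⟦ q ⟧ (∂ʷ k (w ∘ (α ⊕_))))
  ≡⟨ ⟦⟧-+ʷ p _ _ ⟩
    ⟦ p ⟧ (λ α → ⟦ q ⟧ (λ β → ∂ʷ k (w ∘ (_⊕ β)) α)) + ⟦ p ⟧ (λ α → ⟦ q ⟧ (∂ʷ k (w ∘ (α ⊕_))))
  ≡⟨ cong₂ _+_ (⟦⟧-cong p (λ α → ⟦⟧-*ʷ q (+ lookup α k) (w ∘ (updateAt α k ℕ.pred ⊕_))))
               (⟦⟧-cong p (λ α → sym (⟦⟧-∂ k q (w ∘ (α ⊕_))))) ⟩
    ⟦ p ⟧ (∂ʷ k (λ α → ⟦ q ⟧ (w ∘ (α ⊕_)))) + ⟦ p ⟧ (λ α → ⟦ ∂ k q ⟧ (w ∘ (α ⊕_)))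
  ≡⟨ cong₂ _+_ (trans (sym (⟦⟧-∂ k p _)) (sym (⟦⟧-*ᴾ (∂ k p) q w))) (sym (⟦⟧-*ᴾ p (∂ k q) w)) ⟩
    ⟦ ∂ k p *ᴾ q ⟧ w + ⟦ p *ᴾ ∂ k q ⟧ w
  ≡⟨ ⟦⟧-++ (∂ k p *ᴾ q) (p *ᴾ ∂ k q) w ⟨
    ⟦ ∂ k p *ᴾ q +ᴾ p *ᴾ ∂ k q ⟧ w
  ∎
  where open ≡-Reasoning

⟦⟧-∑-*ᴾ : ∀ (r q : Poly N) (F : Fin M → Poly N) → (∀ w → ⟦ r ⟧ w ≡ ∑[ j < M ] ⟦ F j ⟧ w) →
  ∀ w → ⟦ r *ᴾ q ⟧ w ≡ ∑[ j < M ] ⟦ F j *ᴾ q ⟧ w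
⟦⟧-∑-*ᴾ r q F r≡∑F w =
  trans (⟦⟧-*ᴾ r q w) (trans (r≡∑F _) (sum-cong-≗ (λ j → sym (⟦⟧-*ᴾ (F j) q w))))

⟦⟧-*ᴾ-∑ : ∀ (p r : Poly N) (F : Fin M → Poly N) → (∀ w → ⟦ r ⟧ w ≡ ∑[ j < M ] ⟦ F j ⟧ w) →
  ∀ w → ⟦ p *ᴾ r ⟧ w ≡ ∑[ j < M ] ⟦ p *ᴾ F j ⟧ w
⟦⟧-*ᴾ-∑ {M = M} p r F r≡∑F w = begin
    ⟦ p *ᴾ r ⟧ w
  ≡⟨ trans (⟦⟧-*ᴾ p r w) (⟦⟧-cong p (λ α → r≡∑F (w ∘ (α ⊕_)))) ⟩
    ⟦ p ⟧ (λ α → ∑[ j < M ] ⟦ F j ⟧ (w ∘ (α ⊕_)))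
  ≡⟨ ⟦⟧-∑ʷ p (λ j α → ⟦ F j ⟧ (w ∘ (α ⊕_))) ⟩
    ∑[ j < M ] ⟦ p ⟧ (λ α → ⟦ F j ⟧ (w ∘ (α ⊕_)))
  ≡⟨ sum-cong-≗ (λ j → sym (⟦⟧-*ᴾ p (F j) w)) ⟩
    ∑[ j < M ] ⟦ p *ᴾ F j ⟧ w
  ∎
  where open ≡-Reasoning

∇-*ᴾ : ∀ (p q : Poly N) → ∇ (p *ᴾ q) ≋ ∇ p *ᴾ q +ᴾ p *ᴾ ∇ q
∇-*ᴾ {N} p q w = begin
    ⟦ ∇ (p *ᴾ q) ⟧ w
  ≡⟨ trans (⟦⟧-sumᴾ (λ k → ∂ k (p *ᴾ q)) w) (sum-cong-≗ λ k → trans (∂-*ᴾ k p q w) (⟦⟧-++ (∂ k p *ᴾ q) _ w)) ⟩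
    ∑[ k < N ] (⟦ ∂ k p *ᴾ q ⟧ w + ⟦ p *ᴾ ∂ k q ⟧ w)
  ≡⟨ ∑-distrib-+ (λ k → ⟦ ∂ k p *ᴾ q ⟧ w) (λ k → ⟦ p *ᴾ ∂ k q ⟧ w) ⟩
    ∑[ k < N ] ⟦ ∂ k p *ᴾ q ⟧ w + ∑[ k < N ] ⟦ p *ᴾ ∂ k q ⟧ w
  ≡⟨ cong₂ _+_ (⟦⟧-∑-*ᴾ (∇ p) q (λ k → ∂ k p) (⟦⟧-sumᴾ (λ k → ∂ k p)) w)
               (⟦⟧-*ᴾ-∑ p (∇ q) (λ k → ∂ k q) (⟦⟧-sumᴾ (λ k → ∂ k q)) w) ⟨
    ⟦ ∇ p *ᴾ q ⟧ w + ⟦ p *ᴾ ∇ q ⟧ w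
  ≡⟨ ⟦⟧-++ (∇ p *ᴾ q) (p *ᴾ ∇ q) w ⟨
    ⟦ ∇ p *ᴾ q +ᴾ p *ᴾ ∇ q ⟧ w
  ∎
  where open ≡-Reasoning

⟦1ᴾ⟧ : ∀ (w : Weight N) → ⟦ 1ᴾ ⟧ w ≡ w (replicate N 0)
⟦1ᴾ⟧ w = trans (ℤP.+-identityʳ _) (ℤP.*-identityˡ _)

∇-1ᴾ : ∀ w → ⟦ ∇ {N} 1ᴾ ⟧ w ≡ + 0
∇-1ᴾ {N} w = trans (⟦⟧-sumᴾ (λ k → ∂ k 1ᴾ) w) (trans (sum-cong-≗ ∂ₖ1≡0) (sum-replicate-zero N))
  where
    ∂ₖ1≡0 : ∀ k → ⟦ ∂ k 1ᴾ ⟧ w ≡ + 0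
    ∂ₖ1≡0 k = trans (⟦⟧-∂ k 1ᴾ w) (trans (⟦1ᴾ⟧ (∂ʷ k w))
      (trans (cong (λ e → + e * w⁻) (VP.lookup-replicate k 0)) (ℤP.*-zeroˡ w⁻)))
      where w⁻ = w (updateAt (replicate N 0) k ℕ.pred)

∏ᴾ : (Fin M → Poly N) → Poly N
∏ᴾ {M = zero} f = 1ᴾ
∏ᴾ {M = suc M} f = f zero *ᴾ ∏ᴾ (f ∘ suc)

∇-∏ᴾ : ∀ (f : Fin M → Poly N) w → ⟦ ∇ (∏ᴾ f) ⟧ w ≡ ∑[ j < M ] ⟦ ∏ᴾ (VF.updateAt f j ∇) ⟧ w
∇-∏ᴾ {M = zero} f w = ∇-1ᴾ w
∇-∏ᴾ {M = suc M} f w = begin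
    ⟦ ∇ (f zero *ᴾ ∏ᴾ (f ∘ suc)) ⟧ w
  ≡⟨ trans (∇-*ᴾ (f zero) _ w) (⟦⟧-++ (∇ (f zero) *ᴾ ∏ᴾ (f ∘ suc)) _ w) ⟩
    ⟦ ∇ (f zero) *ᴾ ∏ᴾ (f ∘ suc) ⟧ w + ⟦ f zero *ᴾ ∇ (∏ᴾ (f ∘ suc)) ⟧ w
  ≡⟨ cong (λ t → ⟦ ∇ (f zero) *ᴾ ∏ᴾ (f ∘ suc) ⟧ w + t) (⟦⟧-*ᴾ-∑ (f zero) (∇ (∏ᴾ (f ∘ suc))) (λ j → ∏ᴾ (VF.updateAt (f ∘ suc) j ∇)) (∇-∏ᴾ (f ∘ suc)) w) ⟩
    ⟦ ∇ (f zero) *ᴾ ∏ᴾ (f ∘ suc) ⟧ w + ∑[ j < M ] ⟦ f zero *ᴾ ∏ᴾ (VF.updateAt (f ∘ suc) j ∇) ⟧ w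
  ∎
  where open ≡-Reasoning

-- ∇ of a product of complete homogeneous polynomials

*ᴾ-cong : ∀ {p p′ q q′ : Poly N} → p ≋ p′ → q ≋ q′ → p *ᴾ q ≋ p′ *ᴾ q′
*ᴾ-cong {p = p} {p′} {q} {q′} p≋p′ q≋q′ w = begin
    ⟦ p *ᴾ q ⟧ w
  ≡⟨ trans (⟦⟧-*ᴾ p q w) (⟦⟧-cong p (λ α → q≋q′ (w ∘ (α ⊕_)))) ⟩
    ⟦ p ⟧ (λ α → ⟦ q′ ⟧ (w ∘ (α ⊕_)))
  ≡⟨ trans (p≋p′ _) (sym (⟦⟧-*ᴾ p′ q′ w)) ⟩
    ⟦ p′ *ᴾ q′ ⟧ w
  ∎
  where open ≡-Reasoning

scale-*ᴾ : ∀ c (p q : Poly N) → scale c p *ᴾ q ≋ scale c (p *ᴾ q)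
scale-*ᴾ c p q w = begin
    ⟦ scale c p *ᴾ q ⟧ w
  ≡⟨ trans (⟦⟧-*ᴾ (scale c p) q w) (⟦⟧-scale c p _) ⟩
    c * ⟦ p ⟧ (λ α → ⟦ q ⟧ (w ∘ (α ⊕_)))
  ≡⟨ trans (cong (c *_) (sym (⟦⟧-*ᴾ p q w))) (sym (⟦⟧-scale c (p *ᴾ q) w)) ⟩
    ⟦ scale c (p *ᴾ q) ⟧ w
  ∎
  where open ≡-Reasoning

*ᴾ-scale : ∀ (p : Poly N) c q → p *ᴾ scale c q ≋ scale c (p *ᴾ q)
*ᴾ-scale p c q w = begin
    ⟦ p *ᴾ scale c q ⟧ w
  ≡⟨ trans (⟦⟧-*ᴾ p (scale c q) w) (⟦⟧-cong p (λ α → ⟦⟧-scale c q (w ∘ (α ⊕_)))) ⟩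
    ⟦ p ⟧ (λ α → c * ⟦ q ⟧ (w ∘ (α ⊕_)))
  ≡⟨ ⟦⟧-*ʷ p c _ ⟩
    c * ⟦ p ⟧ (λ α → ⟦ q ⟧ (w ∘ (α ⊕_)))
  ≡⟨ trans (cong (c *_) (sym (⟦⟧-*ᴾ p q w))) (sym (⟦⟧-scale c (p *ᴾ q) w)) ⟩
    ⟦ scale c (p *ᴾ q) ⟧ w
  ∎
  where open ≡-Reasoning

*ᴾ-congʳ : ∀ (p : Poly N) {q q′ : Poly N} → q ≋ q′ → p *ᴾ q ≋ p *ᴾ q′
*ᴾ-congʳ p {q} {q′} = *ᴾ-cong {p = p} {p} {q} {q′} (λ _ → refl)

∏ᴾ-cong : ∀ {f g : Fin M → Poly N} → (∀ i → f i ≋ g i) → ∏ᴾ f ≋ ∏ᴾ g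
∏ᴾ-cong {M = zero} f≋g w = refl
∏ᴾ-cong {M = suc M} {f = f} {g} f≋g =
  *ᴾ-cong {p = f zero} {g zero} {∏ᴾ (f ∘ suc)} {∏ᴾ (g ∘ suc)} (f≋g zero) (∏ᴾ-cong (f≋g ∘ suc))

∏ᴾ-updateAt-scale : ∀ (f : Fin M → Poly N) j c → ∏ᴾ (VF.updateAt f j (scale c)) ≋ scale c (∏ᴾ f)
∏ᴾ-updateAt-scale f zero c = scale-*ᴾ c (f zero) (∏ᴾ (f ∘ suc))
∏ᴾ-updateAt-scale f (suc j) c w =
  trans (*ᴾ-congʳ (f zero) (∏ᴾ-updateAt-scale (f ∘ suc) j c) w) (*ᴾ-scale (f zero) c (∏ᴾ (f ∘ suc)) w)

foldr-tabulate-*ᴾ : ∀ (f : Fin N → Poly N) (t : Fin M → Fin N) →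
  foldr (λ i acc → f i *ᴾ acc) 1ᴾ (tabulate t) ≡ ∏ᴾ (f ∘ t)
foldr-tabulate-*ᴾ {M = zero} f t = refl
foldr-tabulate-*ᴾ {M = suc M} f t = cong (f (t zero) *ᴾ_) (foldr-tabulate-*ᴾ f (t ∘ suc))

prodᴾ≡∏ᴾ : ∀ (f : Fin N → Poly N) → prodᴾ f ≡ ∏ᴾ f
prodᴾ≡∏ᴾ f = foldr-tabulate-*ᴾ f (λ i → i)

prodᴾ-cong : ∀ {f g : Fin N → Poly N} → (∀ i → f i ≡ g i) → prodᴾ f ≡ prodᴾ g
prodᴾ-cong {N} f≗g = foldr-cong (λ i acc → cong (_*ᴾ acc) (f≗g i)) refl (allFin N)

-e-same : ∀ (v : Fin N → ℤ) k → (v -e k) k ≡ v k - + 1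
-e-same v k with k F.≟ k
... | yes _ = refl
... | no k≢k = ⊥-elim (k≢k refl)

-e-other : ∀ (v : Fin N → ℤ) {i k} → i ≢ k → (v -e k) i ≡ v i
-e-other v {i} {k} i≢k with i F.≟ k
... | yes i≡k = ⊥-elim (i≢k i≡k)
... | no _ = refl

+e-same : ∀ (v : Fin N → ℤ) k → (v +e k) k ≡ v k + + 1
+e-same v k with k F.≟ k
... | yes _ = refl
... | no k≢k = ⊥-elim (k≢k refl)

+e-other : ∀ (v : Fin N → ℤ) {i k} → i ≢ k → (v +e k) i ≡ v i
+e-other v {i} {k} i≢k with i F.≟ k
... | yes i≡k = ⊥-elim (i≢k i≡k)
... | no _ = refl

updateAt-∇-h : ∀ (n : Fin N → ℤ) j i →
  VF.updateAt (λ i → h (n i)) j ∇ i ≋ VF.updateAt (λ i → h ((n -e j) i)) j (scale (n j + + N - + 1)) i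
updateAt-∇-h {N} n j i w with i F.≟ j
... | yes refl = begin
    ⟦ VF.updateAt (λ i → h (n i)) j ∇ j ⟧ w
  ≡⟨ cong (λ p → ⟦ p ⟧ w) (VFP.updateAt-updates j (λ i → h (n i))) ⟩
    ⟦ ∇ (h (n j)) ⟧ w
  ≡⟨ ≈ᴾ⇒≋ {p = ∇ (h (n j))} {q = scale c (h (n j - + 1))} (∇-h (n j)) w ⟩
    ⟦ scale c (h (n j - + 1)) ⟧ w
  ≡⟨ cong (λ p → ⟦ p ⟧ w) (trans (cong (scale c ∘ h) (sym (-e-same n j)))
                                 (sym (VFP.updateAt-updates j (λ i → h ((n -e j) i))))) ⟩
    ⟦ VF.updateAt (λ i → h ((n -e j) i)) j (scale c) j ⟧ w
  ∎
  where
    open ≡-Reasoning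
    c = n j + + N - + 1
... | no i≢j = cong (λ p → ⟦ p ⟧ w)
  (trans (VFP.updateAt-minimal i j (λ i → h (n i)) i≢j)
  (trans (cong h (sym (-e-other n i≢j))) (sym (VFP.updateAt-minimal i j (λ i → h ((n -e j) i)) i≢j))))

∇-prodᴾ-h : ∀ (n : Fin N → ℤ) →
  ∇ (prodᴾ (λ i → h (n i))) ≋ sumᴾ (λ j → scale (n j + + N - + 1) (prodᴾ (λ i → h ((n -e j) i))))
∇-prodᴾ-h {N} n w = begin
    ⟦ ∇ (prodᴾ (λ i → h (n i))) ⟧ w
  ≡⟨ cong (λ p → ⟦ ∇ p ⟧ w) (prodᴾ≡∏ᴾ (λ i → h (n i))) ⟩
    ⟦ ∇ (∏ᴾ (λ i → h (n i))) ⟧ w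
  ≡⟨ ∇-∏ᴾ (λ i → h (n i)) w ⟩
    ∑[ j < N ] ⟦ ∏ᴾ (VF.updateAt (λ i → h (n i)) j ∇) ⟧ w
  ≡⟨ sum-cong-≗ lowered ⟩
    ∑[ j < N ] ⟦ scale (n j + + N - + 1) (prodᴾ (λ i → h ((n -e j) i))) ⟧ w
  ≡⟨ ⟦⟧-sumᴾ (λ j → scale (n j + + N - + 1) (prodᴾ (λ i → h ((n -e j) i)))) w ⟨
    ⟦ sumᴾ (λ j → scale (n j + + N - + 1) (prodᴾ (λ i → h ((n -e j) i)))) ⟧ w
  ∎
  where
    open ≡-Reasoning
    lowered : ∀ j → ⟦ ∏ᴾ (VF.updateAt (λ i → h (n i)) j ∇) ⟧ w
                  ≡ ⟦ scale (n j + + N - + 1) (prodᴾ (λ i → h ((n -e j) i))) ⟧ w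
    lowered j = trans (∏ᴾ-cong (updateAt-∇-h n j) w)
      (trans (∏ᴾ-updateAt-scale (λ i → h ((n -e j) i)) j (n j + + N - + 1) w)
             (cong (λ p → ⟦ scale (n j + + N - + 1) p ⟧ w) (sym (prodᴾ≡∏ᴾ (λ i → h ((n -e j) i))))))

⟦⟧-sumᴾ-scale : ∀ (c : Fin N → ℤ) (P : Fin N → Poly N) w →
  ⟦ sumᴾ (λ k → scale (c k) (P k)) ⟧ w ≡ ∑[ k < N ] (c k * ⟦ P k ⟧ w)
⟦⟧-sumᴾ-scale c P w = trans (⟦⟧-sumᴾ (λ k → scale (c k) (P k)) w) (sum-cong-≗ (λ k → ⟦⟧-scale (c k) (P k) w))

-e-sub : ∀ (u v : Fin N → ℤ) k i → (u -e k) i - v i ≡ ((λ i → u i - v i) -e k) i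
-e-sub u v k i with i F.≟ k
... | yes _ = swap (u i) (v i)
  where
    swap : ∀ x y → x - + 1 - y ≡ x - y - + 1
    swap = solve-∀
... | no _ = refl

sub-+e : ∀ (u v : Fin N → ℤ) k i → u i - (v +e k) i ≡ ((λ i → u i - v i) -e k) i
sub-+e u v k i with i F.≟ k
... | yes _ = distrib (u i) (v i)
  where
    distrib : ∀ x y → x - (y + + 1) ≡ x - y - + 1
    distrib = solve-∀
... | no _ = refl

+e-∘-permutation : ∀ (σ : Permutation′ N) (v : Fin N → ℤ) k i →
  (v +e k) (σ ⟨$⟩ʳ i) ≡ ((λ i → v (σ ⟨$⟩ʳ i)) +e (σ ⟨$⟩ˡ k)) i
+e-∘-permutation σ v k i with i F.≟ σ ⟨$⟩ˡ k
... | yes refl = trans (cong (v +e k) (inverseʳ σ)) (trans (+e-same v k) (cong (λ j → v j + + 1) (sym (inverseʳ σ))))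
... | no i≢σ⁻¹k = +e-other v (λ σi≡k → i≢σ⁻¹k (trans (sym (inverseˡ σ)) (cong (σ ⟨$⟩ˡ_) σi≡k)))

∑-split-permute : ∀ (σ : Permutation′ N) (ℓ m : Fin N → ℤ) a b → a + b ≡ + N - + 1 → ∀ (E : Fin N → ℤ) →
  ∑[ j < N ] ((ℓ j - m (σ ⟨$⟩ʳ j) + + N - + 1) * E j)
    ≡ ∑[ k < N ] ((ℓ k + a) * E k) + ∑[ k < N ] ((b - m k) * E (σ ⟨$⟩ˡ k))
∑-split-permute {N} σ ℓ m a b a+b≡N-1 E = begin
    ∑[ j < N ] ((ℓ j - m (σ ⟨$⟩ʳ j) + + N - + 1) * E j)
  ≡⟨ sum-cong-≗ split ⟩
    ∑[ j < N ] ((ℓ j + a) * E j + (b - m (σ ⟨$⟩ʳ j)) * E j)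
  ≡⟨ ∑-distrib-+ (λ j → (ℓ j + a) * E j) (λ j → (b - m (σ ⟨$⟩ʳ j)) * E j) ⟩
    ∑[ j < N ] ((ℓ j + a) * E j) + ∑[ j < N ] ((b - m (σ ⟨$⟩ʳ j)) * E j)
  ≡⟨ cong (λ t → ∑[ j < N ] ((ℓ j + a) * E j) + t) permute ⟨
    ∑[ k < N ] ((ℓ k + a) * E k) + ∑[ k < N ] ((b - m k) * E (σ ⟨$⟩ˡ k))
  ∎
  where
    open ≡-Reasoning
    regroup : ∀ l μ a b e → (l - μ + (a + b)) * e ≡ (l + a) * e + (b - μ) * e
    regroup = solve-∀
    split : ∀ j → (ℓ j - m (σ ⟨$⟩ʳ j) + + N - + 1) * E j ≡ (ℓ j + a) * E j + (b - m (σ ⟨$⟩ʳ j)) * E j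
    split j = trans (cong (_* E j) (trans (ℤP.+-assoc (ℓ j - m (σ ⟨$⟩ʳ j)) (+ N) (- + 1))
                                          (cong (_+_ (ℓ j - m (σ ⟨$⟩ʳ j))) (sym a+b≡N-1))))
                    (regroup (ℓ j) (m (σ ⟨$⟩ʳ j)) a b (E j))
    permute : ∑[ k < N ] ((b - m k) * E (σ ⟨$⟩ˡ k)) ≡ ∑[ j < N ] ((b - m (σ ⟨$⟩ʳ j)) * E j)
    permute = trans (sum-permute (λ k → (b - m k) * E (σ ⟨$⟩ˡ k)) σ)
                    (sum-cong-≗ (λ j → cong (λ i → (b - m (σ ⟨$⟩ʳ j)) * E i) (inverseˡ σ)))

mainTheorem7 : (N : ℕ) (σ : Permutation′ N) (ℓ m : Fin N → ℤ) (a b : ℤ) →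
    a + b ≡ + N - + 1 →
    ∇ (prodᴾ (λ i → h (ℓ i - m (σ ⟨$⟩ʳ i))))
      ≈ᴾ
    sumᴾ (λ k → scale (ℓ k + a) (prodᴾ (λ i → h ((ℓ -e k) i - m (σ ⟨$⟩ʳ i)))))
      +ᴾ sumᴾ (λ k → scale (b - m k) (prodᴾ (λ i → h (ℓ i - (m +e k) (σ ⟨$⟩ʳ i)))))
mainTheorem7 N σ ℓ m a b a+b≡N-1 = ≋⇒≈ᴾ {p = ∇ (prodᴾ (λ i → h (n i)))} {q = Σ-lowered +ᴾ Σ-raised} λ w → begin
    ⟦ ∇ (prodᴾ (λ i → h (n i))) ⟧ w
  ≡⟨ trans (∇-prodᴾ-h n w) (⟦⟧-sumᴾ-scale (λ j → n j + + N - + 1) P w) ⟩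
    ∑[ j < N ] ((n j + + N - + 1) * ⟦ P j ⟧ w)
  ≡⟨ ∑-split-permute σ ℓ m a b a+b≡N-1 (λ j → ⟦ P j ⟧ w) ⟩
    ∑[ k < N ] ((ℓ k + a) * ⟦ P k ⟧ w) + ∑[ k < N ] ((b - m k) * ⟦ P (σ ⟨$⟩ˡ k) ⟧ w)
  ≡⟨ cong₂ _+_ (trans (⟦⟧-sumᴾ-scale (λ k → ℓ k + a) _ w) (sum-cong-≗ λ k →
                  cong (λ p → (ℓ k + a) * ⟦ p ⟧ w) (prodᴾ-cong (cong h ∘ -e-sub ℓ (m ∘ (σ ⟨$⟩ʳ_)) k))))
               (trans (⟦⟧-sumᴾ-scale (λ k → b - m k) _ w) (sum-cong-≗ λ k →
                  cong (λ p → (b - m k) * ⟦ p ⟧ w) (prodᴾ-cong (cong h ∘ raised k)))) ⟨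
    ⟦ Σ-lowered ⟧ w + ⟦ Σ-raised ⟧ w
  ≡⟨ ⟦⟧-++ Σ-lowered Σ-raised w ⟨
    ⟦ Σ-lowered +ᴾ Σ-raised ⟧ w
  ∎
  where
    open ≡-Reasoning
    n : Fin N → ℤ
    n i = ℓ i - m (σ ⟨$⟩ʳ i)
    P : Fin N → Poly N
    P j = prodᴾ (λ i → h ((n -e j) i))
    Σ-lowered Σ-raised : Poly N
    Σ-lowered = sumᴾ (λ k → scale (ℓ k + a) (prodᴾ (λ i → h ((ℓ -e k) i - m (σ ⟨$⟩ʳ i)))))
    Σ-raised = sumᴾ (λ k → scale (b - m k) (prodᴾ (λ i → h (ℓ i - (m +e k) (σ ⟨$⟩ʳ i)))))
    raised : ∀ k i → ℓ i - (m +e k) (σ ⟨$⟩ʳ i) ≡ (n -e (σ ⟨$⟩ˡ k)) i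
    raised k i = trans (cong (_-_ (ℓ i)) (+e-∘-permutation σ m k i)) (sub-+e ℓ (m ∘ (σ ⟨$⟩ʳ_)) (σ ⟨$⟩ˡ k) i)
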